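{- Let $n\geq 3$ and let $\mathcal{F}\subseteq 2^{[n]}$ be a family of subsets of $[n]=\{1,\ldots,n\}$ containing no four distinct members $A,B,C,D\in\mathcal{F}$ with $A\cup B\subseteq C\cap D$. Then $$|\mathcal{F}|\leq \binom{n}{\lfloor n/2\rfloor}+\binom{n}{\lfloor n/2\rfloor+1}.$$ -}

module Defs where

open import Data.Nat using (ℕ)
open import Data.Fin.Subset using (Subset; _⊆_; _∪_; _∩_)
open import Data.List using (List)
open import Data.List.Membership.Propositional using (_∈_)
open import Data.Empty using (⊥)
open import Relation.Binary.PropositionalEquality using (_≢_)

-- A family F ⊆ 2^[n] is a duplicate-free list of subsets of Fin n.
-- "Forbidden configuration": four pairwise distinct members A,B,C,D of F
-- with A ∪ B ⊆ C ∩ D.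
Forbidden : {n : ℕ} → List (Subset n) → Set
Forbidden {n} F =
  (A B C D : Subset n) →
  A ∈ F → B ∈ F → C ∈ F → D ∈ F →
  A ≢ B → A ≢ C → A ≢ D → B ≢ C → B ≢ D → C ≢ D →
  (A ∪ B) ⊆ (C ∩ D) → ⊥

module Submission where

-- Weighted double counting over the n! maximal chains of 2^[n], in the manner of the
-- LYM inequality. Give X ∈ F the weight C(n,|X|); since X lies on |X|!(n−|X|)! maximal
-- chains, the chains see a total weight |F|·n!, and it suffices to show that on average a
-- chain sees weight at most S = C(n,⌊n/2⌋) + C(n,⌊n/2⌋+1).
--
-- Call B ∈ F middle if A ⊂ B ⊂ D for some A, D ∈ F. A butterfly-free family contains no
-- four-element chain, so the A and D of a middle B are unique and distinct middle members
-- are incomparable; a maximal chain thus contains at most one middle member. A chain without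
-- one meets F in at most two sets, of different sizes, so it sees weight at most S, as
-- C(n,i) + C(n,j) ≤ S for i ≠ j. The chains through a middle B meet F only in A, B and D, and
-- only a fraction 1/C(|B|,|A|) ≤ 1/2 of them pass through A unless A = ∅, where C(n,|A|) = 1
-- (symmetrically for D); this keeps their average weight at most S as well.

open import Defs
open import Data.Bool.Base using (Bool; true; false; T; _∧_; if_then_else_)
open import Data.Bool.Properties using (T-∧) renaming (_≟_ to _≟ᵇ_)
open import Data.Empty using (⊥; ⊥-elim)
open import Data.Fin.Base using (Fin; zero; suc)
open import Data.Fin.Subset using (Subset; _⊆_; _⊂_; _∪_; _∩_; ∣_∣; inside; outside; Nonempty; Empty)
  renaming (_∈_ to _∈ˢ_)
open import Data.Fin.Subset.Properties
  using (nonempty?; drop-∷-⊆; out⊆; s⊆s; out⊂; out⊂in; s⊂s; ⊂-irref; ⊂-trans; _⊂?_; x∈p∪q⁻; x∈p∩q⁺;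
         p⊆q⇒∣p∣≤∣q∣; p⊂q⇒p⊆q; p⊂q⇒∣p∣<∣q∣; ∣p∣≤n; Empty-unique; ∣⊥∣≡0)
open import Data.List.Base using (List; []; _∷_; [_]; map; length; _++_; filter; cartesianProduct; allFin)
open import Data.List.Properties using (map-++; map-tabulate; length-tabulate)
open import Data.List.Membership.Propositional using (_∈_; find; lose)
open import Data.List.Membership.Propositional.Properties using (∈-filter⁻)
open import Data.List.Relation.Unary.All as All using ([]; _∷_)
open import Data.List.Relation.Unary.Any using (Any; any?; here; there)
open import Data.List.Relation.Unary.Unique.Propositional using (Unique; []; _∷_)
open import Data.List.Relation.Unary.Unique.Propositional.Properties using (filter⁺)
open import Data.Nat.Base
open import Data.Nat.Combinatorics
open import Data.Nat.DivMod using (_/_; _%_; m/n*n≡m; m≡m%n+[m/n]*n; m%n<n)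
open import Data.Nat.ListAction using (sum)
open import Data.Nat.ListAction.Properties using (sum-++)
open import Data.Nat.Properties
open import Data.Nat.Tactic.RingSolver using (solve-∀)
open import Data.Product.Base using (_×_; _,_; proj₁; proj₂)
open import Data.Sum.Base as Sum using (_⊎_; inj₁; inj₂)
open import Data.Unit.Base using (⊤; tt)
open import Data.Vec.Base using ([]; _∷_; lookup; removeAt; here; there)
open import Data.Vec.Properties using (lookup⇒[]=; []=⇒lookup; ≡-dec)
open import Function.Base using (id; _∘_)
open import Function.Bundles using (Equivalence)
open import Relation.Binary.Definitions using (DecidableEquality; tri<; tri≈; tri>)
open import Relation.Binary.PropositionalEquality hiding ([_])
open import Relation.Nullary using (¬_; Dec; yes; no; contradiction)
open import Relation.Nullary.Decidable using (isYes; toWitness; fromWitness; _×-dec_; T?)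
open import Relation.Unary using (Decidable)

open Equivalence using (to)

private
  variable
    A B : Set
    n : ℕ

-- Sums over lists

⟦_⟧ : Bool → ℕ
⟦ true  ⟧ = 1
⟦ false ⟧ = 0

⟦∧⟧ : ∀ a b → ⟦ a ∧ b ⟧ ≡ ⟦ a ⟧ * ⟦ b ⟧
⟦∧⟧ false b = refl
⟦∧⟧ true  b = sym (+-identityʳ ⟦ b ⟧)

⟦b⟧*⟦b⟧≡⟦b⟧ : ∀ b → ⟦ b ⟧ * ⟦ b ⟧ ≡ ⟦ b ⟧
⟦b⟧*⟦b⟧≡⟦b⟧ true  = refl
⟦b⟧*⟦b⟧≡⟦b⟧ false = refl

⟦p∧s⟧*⟦q∧t⟧≡⟦p⟧*[⟦s⟧*⟦t⟧] : ∀ {p q} s t → (T p → T q) →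
                            ⟦ p ∧ s ⟧ * ⟦ q ∧ t ⟧ ≡ ⟦ p ⟧ * (⟦ s ⟧ * ⟦ t ⟧)
⟦p∧s⟧*⟦q∧t⟧≡⟦p⟧*[⟦s⟧*⟦t⟧] {false}        s t _   = refl
⟦p∧s⟧*⟦q∧t⟧≡⟦p⟧*[⟦s⟧*⟦t⟧] {true} {true}  s t _   = sym (+-identityʳ (⟦ s ⟧ * ⟦ t ⟧))
⟦p∧s⟧*⟦q∧t⟧≡⟦p⟧*[⟦s⟧*⟦t⟧] {true} {false} s t p⇒q = contradiction (p⇒q _) λ ()

T⇒⟦⟧≡1 : ∀ {b} → T b → ⟦ b ⟧ ≡ 1
T⇒⟦⟧≡1 {true} _ = refl

¬T⇒⟦⟧≡0 : ∀ {b} → ¬ T b → ⟦ b ⟧ ≡ 0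
¬T⇒⟦⟧≡0 {false} _  = refl
¬T⇒⟦⟧≡0 {true}  ¬t = contradiction _ ¬t

⟦⟧*-monoʳ-≤ : ∀ b {x y} → (T b → x ≤ y) → ⟦ b ⟧ * x ≤ ⟦ b ⟧ * y
⟦⟧*-monoʳ-≤ true  x≤y = +-monoˡ-≤ 0 (x≤y _)
⟦⟧*-monoʳ-≤ false _   = z≤n

∑ : List A → (A → ℕ) → ℕ
∑ xs f = sum (map f xs)

syntax ∑ xs (λ x → e) = ∑[ x ← xs ] e

∑-cong : ∀ (xs : List A) {f g : A → ℕ} → (∀ {x} → x ∈ xs → f x ≡ g x) → ∑ xs f ≡ ∑ xs g
∑-cong []       f≗g = refl
∑-cong (x ∷ xs) f≗g = cong₂ _+_ (f≗g (here refl)) (∑-cong xs (f≗g ∘ there))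

∑-mono : ∀ (xs : List A) {f g : A → ℕ} → (∀ {x} → x ∈ xs → f x ≤ g x) → ∑ xs f ≤ ∑ xs g
∑-mono []       f≤g = z≤n
∑-mono (x ∷ xs) f≤g = +-mono-≤ (f≤g (here refl)) (∑-mono xs (f≤g ∘ there))

∑-const : ∀ (xs : List A) k → ∑[ _ ← xs ] k ≡ length xs * k
∑-const []       k = refl
∑-const (x ∷ xs) k = cong (k +_) (∑-const xs k)

∑-zero : ∀ (xs : List A) → ∑[ _ ← xs ] 0 ≡ 0
∑-zero xs = trans (∑-const xs 0) (*-zeroʳ (length xs))

∑-distrib-+ : ∀ (xs : List A) (f g : A → ℕ) → ∑[ x ← xs ] (f x + g x) ≡ ∑ xs f + ∑ xs g
∑-distrib-+ []       f g = refl
∑-distrib-+ (x ∷ xs) f g = trans (cong (f x + g x +_) (∑-distrib-+ xs f g)) (shuffle (f x) (g x) _ _)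
  where
  shuffle : ∀ a b c d → a + b + (c + d) ≡ a + c + (b + d)
  shuffle = solve-∀

∑-distribˡ-* : ∀ (xs : List A) k (f : A → ℕ) → ∑[ x ← xs ] (k * f x) ≡ k * ∑ xs f
∑-distribˡ-* []       k f = sym (*-zeroʳ k)
∑-distribˡ-* (x ∷ xs) k f = trans (cong (k * f x +_) (∑-distribˡ-* xs k f)) (sym (*-distribˡ-+ k (f x) _))

∑-distribʳ-* : ∀ (xs : List A) k (f : A → ℕ) → ∑ xs f * k ≡ ∑[ x ← xs ] (f x * k)
∑-distribʳ-* xs k f = begin
  ∑ xs f * k             ≡⟨ *-comm (∑ xs f) k ⟩
  k * ∑ xs f             ≡⟨ ∑-distribˡ-* xs k f ⟨
  ∑[ x ← xs ] (k * f x)  ≡⟨ ∑-cong xs (λ {x} _ → *-comm k (f x)) ⟩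
  ∑[ x ← xs ] (f x * k)  ∎
  where open ≡-Reasoning

∈⇒≤∑ : ∀ {xs : List A} (f : A → ℕ) {x} → x ∈ xs → f x ≤ ∑ xs f
∈⇒≤∑ f (here refl)  = m≤m+n _ _
∈⇒≤∑ f (there x∈xs) = ≤-trans (∈⇒≤∑ f x∈xs) (m≤n+m _ _)

∑-comm : ∀ (xs : List A) (ys : List B) (f : A → B → ℕ) →
         ∑[ x ← xs ] ∑[ y ← ys ] f x y ≡ ∑[ y ← ys ] ∑[ x ← xs ] f x y
∑-comm []       ys f = sym (∑-zero ys)
∑-comm (x ∷ xs) ys f = begin
  ∑ ys (f x) + ∑[ x′ ← xs ] ∑[ y ← ys ] f x′ y  ≡⟨ cong (∑ ys (f x) +_) (∑-comm xs ys f) ⟩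
  ∑ ys (f x) + ∑[ y ← ys ] ∑[ x′ ← xs ] f x′ y  ≡⟨ ∑-distrib-+ ys (f x) _ ⟨
  ∑[ y ← ys ] (f x y + ∑[ x′ ← xs ] f x′ y)     ∎
  where open ≡-Reasoning

∑-map : ∀ (g : A → B) (xs : List A) (f : B → ℕ) → ∑ (map g xs) f ≡ ∑ xs (f ∘ g)
∑-map g []       f = refl
∑-map g (x ∷ xs) f = cong (f (g x) +_) (∑-map g xs f)

∑-++ : ∀ (xs ys : List A) (f : A → ℕ) → ∑ (xs ++ ys) f ≡ ∑ xs f + ∑ ys f
∑-++ xs ys f = trans (cong sum (map-++ f xs ys)) (sum-++ (map f xs) (map f ys))

∑-cartesianProduct : ∀ (xs : List A) (ys : List B) (f : A × B → ℕ) →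
                     ∑ (cartesianProduct xs ys) f ≡ ∑[ x ← xs ] ∑[ y ← ys ] f (x , y)
∑-cartesianProduct []       ys f = refl
∑-cartesianProduct (x ∷ xs) ys f = begin
  ∑ (map (x ,_) ys ++ cartesianProduct xs ys) f                ≡⟨ ∑-++ (map (x ,_) ys) _ f ⟩
  ∑ (map (x ,_) ys) f + ∑ (cartesianProduct xs ys) f           ≡⟨ cong₂ _+_ (∑-map (x ,_) ys f)
                                                                             (∑-cartesianProduct xs ys f) ⟩
  ∑[ y ← ys ] f (x , y) + ∑[ x′ ← xs ] ∑[ y ← ys ] f (x′ , y)  ∎
  where open ≡-Reasoning

∑-allFin-suc : ∀ (f : Fin (suc n) → ℕ) → ∑ (allFin (suc n)) f ≡ f zero + ∑[ x ← allFin n ] f (suc x)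
∑-allFin-suc {n} f =
  cong (f zero +_) (trans (cong (λ xs → ∑ xs f) (sym (map-tabulate id suc))) (∑-map suc (allFin n) f))

∑-filter : ∀ (p : A → Bool) (xs : List A) (f : A → ℕ) →
           ∑ (filter (T? ∘ p) xs) f ≡ ∑[ x ← xs ] (⟦ p x ⟧ * f x)
∑-filter p []       f = refl
∑-filter p (x ∷ xs) f with p x
... | true  = cong₂ _+_ (sym (+-identityʳ (f x))) (∑-filter p xs f)
... | false = ∑-filter p xs f

∑-indicator≤1 : ∀ {xs : List A} (p : A → Bool) → Unique xs →
                (∀ {x y} → x ∈ xs → y ∈ xs → T (p x) → T (p y) → x ≡ y) →
                ∑[ x ← xs ] ⟦ p x ⟧ ≤ 1
∑-indicator≤1 p [] _ = z≤n
∑-indicator≤1 {xs = x ∷ xs} p (x∉xs ∷ unique) p-unique with p x in px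
... | false = ∑-indicator≤1 p unique (λ y∈xs z∈xs → p-unique (there y∈xs) (there z∈xs))
... | true  = ≤-reflexive (cong suc (trans (∑-cong xs vanish) (∑-zero xs)))
  where
  vanish : ∀ {y} → y ∈ xs → ⟦ p y ⟧ ≡ 0
  vanish {y} y∈xs with p y in py
  ... | false = refl
  ... | true  = contradiction (p-unique (here refl) (there y∈xs) (subst T (sym px) _) (subst T (sym py) _))
                              (All.lookup x∉xs y∈xs)

∑-≟-≤ : ∀ (_≟_ : DecidableEquality A) {xs : List A} y k → Unique xs →
        ∑[ x ← xs ] (⟦ isYes (x ≟ y) ⟧ * k) ≤ k
∑-≟-≤ _≟_ {xs} y k unique = begin
  ∑[ x ← xs ] (⟦ isYes (x ≟ y) ⟧ * k)  ≡⟨ ∑-distribʳ-* xs k _ ⟨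
  ∑[ x ← xs ] ⟦ isYes (x ≟ y) ⟧ * k    ≤⟨ *-monoˡ-≤ k (∑-indicator≤1 (λ x → isYes (x ≟ y)) unique
                                            (λ _ _ x≡y x′≡y → trans (toWitness x≡y) (sym (toWitness x′≡y)))) ⟩
  1 * k                                ≡⟨ *-identityˡ k ⟩
  k                                    ∎
  where open ≤-Reasoning

-- Binomial coefficients

nCk*[k!*[n∸k]!]≡n! : ∀ {n k} → k ≤ n → (n C k) * (k ! * (n ∸ k) !) ≡ n !
nCk*[k!*[n∸k]!]≡n! {n} {k} k≤n = begin
  (n C k) * (k ! * (n ∸ k) !)                  ≡⟨ cong (_* (k ! * (n ∸ k) !)) (nCk≡n!/k![n-k]! k≤n) ⟩
  n ! / (k ! * (n ∸ k) !) * (k ! * (n ∸ k) !)  ≡⟨ m/n*n≡m (k![n∸k]!∣n! k≤n) ⟩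
  n !                                          ∎
  where
  open ≡-Reasoning
  instance _ = k !* (n ∸ k) !≢0

nC0≡1 : ∀ n → n C 0 ≡ 1
nC0≡1 n = trans (nCk≡nC[n∸k] (z≤n {n})) (nCn≡1 n)

0<nCk : ∀ {n k} → k ≤ n → 0 < n C k
0<nCk {n} {k} k≤n = n≢0⇒n>0 λ nCk≡0 → ≢-nonZero⁻¹ (n !) (begin
  n !                          ≡⟨ nCk*[k!*[n∸k]!]≡n! k≤n ⟨
  (n C k) * (k ! * (n ∸ k) !)  ≡⟨ cong (_* (k ! * (n ∸ k) !)) nCk≡0 ⟩
  0                            ∎)
  where
  open ≡-Reasoning
  instance _ = n !≢0

2≤nCk : ∀ {n k} → 0 < k → k < n → 2 ≤ n C k
2≤nCk {suc n} {suc k} _ (s≤s k<n) = begin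
  1 + 1              ≤⟨ +-mono-≤ (0<nCk (<⇒≤ k<n)) (0<nCk k<n) ⟩
  n C k + n C suc k  ≡⟨ nCk+nC[k+1]≡[n+1]C[k+1] n k ⟩
  suc n C suc k      ∎
  where open ≤-Reasoning

[1+k]*nC[1+k]≡[n∸k]*nCk : ∀ n k → suc k * (n C suc k) ≡ (n ∸ k) * (n C k)
[1+k]*nC[1+k]≡[n∸k]*nCk n k with k <? n
... | no k≮n = begin
  suc k * (n C suc k)  ≡⟨ cong (suc k *_) (k>n⇒nCk≡0 (s≤s (≮⇒≥ k≮n))) ⟩
  suc k * 0            ≡⟨ *-zeroʳ (suc k) ⟩
  0                    ≡⟨ cong (_* (n C k)) (m≤n⇒m∸n≡0 (≮⇒≥ k≮n)) ⟨
  (n ∸ k) * (n C k)    ∎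
  where open ≡-Reasoning
... | yes k<n = *-cancelʳ-≡ _ _ (k ! * (n ∸ k) !) (begin
  suc k * (n C suc k) * (k ! * (n ∸ k) !)               ≡⟨ reorder₁ (suc k) (n C suc k) (k ! * (n ∸ k) !) ⟩
  (n C suc k) * (suc k * (k ! * (n ∸ k) !))             ≡⟨ cong ((n C suc k) *_) ([n-k]*d[k+1]≡[k+1]*d[k] k<n) ⟨
  (n C suc k) * ((n ∸ k) * (suc k ! * (n ∸ suc k) !))   ≡⟨ reorder₂ (n C suc k) (n ∸ k) (suc k ! * (n ∸ suc k) !) ⟩
  (n ∸ k) * ((n C suc k) * (suc k ! * (n ∸ suc k) !))   ≡⟨ cong ((n ∸ k) *_) (nCk*[k!*[n∸k]!]≡n! k<n) ⟩
  (n ∸ k) * n !                                         ≡⟨ cong ((n ∸ k) *_) (nCk*[k!*[n∸k]!]≡n! (<⇒≤ k<n)) ⟨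
  (n ∸ k) * ((n C k) * (k ! * (n ∸ k) !))               ≡⟨ *-assoc (n ∸ k) (n C k) _ ⟨
  (n ∸ k) * (n C k) * (k ! * (n ∸ k) !)                 ∎)
  where
  open ≡-Reasoning
  instance _ = k !* (n ∸ k) !≢0
  reorder₁ : ∀ a b c → a * b * c ≡ b * (a * c)
  reorder₁ = solve-∀
  reorder₂ : ∀ a b c → a * (b * c) ≡ b * (a * c)
  reorder₂ = solve-∀

nCk≤nC[1+k] : ∀ {n k} → k < n ∸ k → n C k ≤ n C suc k
nCk≤nC[1+k] {n} {k} k<n∸k = *-cancelˡ-≤ (suc k) (begin
  suc k * (n C k)      ≤⟨ *-monoˡ-≤ (n C k) k<n∸k ⟩
  (n ∸ k) * (n C k)    ≡⟨ [1+k]*nC[1+k]≡[n∸k]*nCk n k ⟨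
  suc k * (n C suc k)  ∎)
  where open ≤-Reasoning

nC[1+k]≤nCk : ∀ {n k} → n ∸ k ≤ suc k → n C suc k ≤ n C k
nC[1+k]≤nCk {n} {k} n∸k≤1+k = *-cancelˡ-≤ (suc k) (begin
  suc k * (n C suc k)  ≡⟨ [1+k]*nC[1+k]≡[n∸k]*nCk n k ⟩
  (n ∸ k) * (n C k)    ≤⟨ *-monoˡ-≤ (n C k) n∸k≤1+k ⟩
  suc k * (n C k)      ∎)
  where open ≤-Reasoning

nCj≤nCk : ∀ {n j k} → j ≤′ k → k + k ≤ n → n C j ≤ n C k
nCj≤nCk ≤′-refl _ = ≤-refl
nCj≤nCk {n} (≤′-step {k} j≤′k) [1+k]+[1+k]≤n =
  ≤-trans (nCj≤nCk j≤′k (≤-trans (+-mono-≤ (n≤1+n k) (n≤1+n k)) [1+k]+[1+k]≤n))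
          (nCk≤nC[1+k] (m+n≤o⇒m≤o∸n (suc k) (≤-trans (+-monoʳ-≤ (suc k) (n≤1+n k)) [1+k]+[1+k]≤n)))

nCk≤nCj : ∀ {n j k} → j ≤′ k → n ≤ suc (j + j) → n C k ≤ n C j
nCk≤nCj ≤′-refl _ = ≤-refl
nCk≤nCj {n} {j} (≤′-step {k} j≤′k) n≤1+j+j = ≤-trans (nC[1+k]≤nCk n∸k≤1+k) (nCk≤nCj j≤′k n≤1+j+j)
  where
  open ≤-Reasoning
  j≤k = ≤′⇒≤ j≤′k
  n∸k≤1+k : n ∸ k ≤ suc k
  n∸k≤1+k = m≤n+o⇒m∸n≤o n k (begin
    n            ≤⟨ n≤1+j+j ⟩
    suc (j + j)  ≤⟨ s≤s (+-mono-≤ j≤k j≤k) ⟩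
    suc (k + k)  ≡⟨ +-suc k k ⟨
    k + suc k    ∎)

n≡[n/2]+[n/2]+n%2 : ∀ n → n ≡ n / 2 + n / 2 + n % 2
n≡[n/2]+[n/2]+n%2 n = trans (m≡m%n+[m/n]*n n 2) (rearrange (n % 2) (n / 2))
  where
  rearrange : ∀ r h → r + h * 2 ≡ h + h + r
  rearrange = solve-∀

[n/2]+[n/2]≤n : ∀ n → n / 2 + n / 2 ≤ n
[n/2]+[n/2]≤n n = ≤-trans (m≤m+n _ (n % 2)) (≤-reflexive (sym (n≡[n/2]+[n/2]+n%2 n)))

n≤1+[n/2]+[n/2] : ∀ n → n ≤ suc (n / 2 + n / 2)
n≤1+[n/2]+[n/2] n = begin
  n                      ≡⟨ n≡[n/2]+[n/2]+n%2 n ⟩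
  n / 2 + n / 2 + n % 2  ≤⟨ +-monoʳ-≤ (n / 2 + n / 2) (s≤s⁻¹ (m%n<n n 2)) ⟩
  n / 2 + n / 2 + 1      ≡⟨ +-comm _ 1 ⟩
  suc (n / 2 + n / 2)    ∎
  where open ≤-Reasoning

nCk≤nC[n/2] : ∀ n k → n C k ≤ n C (n / 2)
nCk≤nC[n/2] n k with k ≤? n / 2
... | yes k≤h = nCj≤nCk (≤⇒≤′ k≤h) ([n/2]+[n/2]≤n n)
... | no  k≰h = nCk≤nCj (≤⇒≤′ (<⇒≤ (≰⇒> k≰h))) (n≤1+[n/2]+[n/2] n)

n/2<k⇒nCk≤nC[1+n/2] : ∀ {n k} → n / 2 < k → n C k ≤ n C suc (n / 2)
n/2<k⇒nCk≤nC[1+n/2] {n} h<k =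
  nCk≤nCj (≤⇒≤′ h<k) (≤-trans (n≤1+[n/2]+[n/2] n) (s≤s (+-mono-≤ (n≤1+n _) (n≤1+n _))))

nCk≤nC[1+n/2] : ∀ {n k} → k ≢ n / 2 → n C k ≤ n C suc (n / 2)
nCk≤nC[1+n/2] {n} {k} k≢h with <-cmp k (n / 2)
... | tri≈ _ k≡h _ = contradiction k≡h k≢h
... | tri> _ _ h<k = n/2<k⇒nCk≤nC[1+n/2] h<k
... | tri< k<h _ _ = begin
  n C k            ≡⟨ nCk≡nC[n∸k] (≤-trans (<⇒≤ k<h) (m+n≤o⇒m≤o (n / 2) ([n/2]+[n/2]≤n n))) ⟩
  n C (n ∸ k)      ≤⟨ n/2<k⇒nCk≤nC[1+n/2] (m+n≤o⇒m≤o∸n (suc (n / 2)) (begin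
                        suc (n / 2) + k  ≡⟨ +-suc (n / 2) k ⟨
                        n / 2 + suc k    ≤⟨ +-monoʳ-≤ (n / 2) k<h ⟩
                        n / 2 + n / 2    ≤⟨ [n/2]+[n/2]≤n n ⟩
                        n                ∎)) ⟩
  n C suc (n / 2)  ∎
  where open ≤-Reasoning

1+n/2<n : ∀ {n} → 3 ≤ n → suc (n / 2) < n
1+n/2<n {n} 3≤n = bound (n / 2) ([n/2]+[n/2]≤n n) (n≤1+[n/2]+[n/2] n)
  where
  bound : ∀ h → h + h ≤ n → n ≤ suc (h + h) → suc h < n
  bound zero          _     n≤1 = contradiction (≤-trans 3≤n n≤1) λ { (s≤s ()) }
  bound (suc zero)    _     _   = 3≤n
  bound (suc (suc h)) h+h≤n _   = ≤-trans (s≤s (s≤s (m≤n+m (suc (suc h)) h))) h+h≤n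

twoLayers : ℕ → ℕ
twoLayers n = n C (n / 2) + n C (n / 2 + 1)

twoLayers≡ : ∀ n → twoLayers n ≡ n C (n / 2) + n C suc (n / 2)
twoLayers≡ n = cong (λ m → n C (n / 2) + n C m) (+-comm (n / 2) 1)

nCk≤twoLayers : ∀ n k → n C k ≤ twoLayers n
nCk≤twoLayers n k = ≤-trans (nCk≤nC[n/2] n k) (m≤m+n _ _)

nCi+nCj≤twoLayers : ∀ {n i j} → i ≢ j → n C i + n C j ≤ twoLayers n
nCi+nCj≤twoLayers {n} {i} {j} i≢j = ≤-trans (by-cases (i ≟ n / 2)) (≤-reflexive (sym (twoLayers≡ n)))
  where
  by-cases : Dec (i ≡ n / 2) → n C i + n C j ≤ n C (n / 2) + n C suc (n / 2)
  by-cases (yes refl) = +-monoʳ-≤ (n C i) (nCk≤nC[1+n/2] (i≢j ∘ sym))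
  by-cases (no i≢h)   = ≤-trans (≤-reflexive (+-comm (n C i) (n C j)))
                                (+-mono-≤ (nCk≤nC[n/2] n j) (nCk≤nC[1+n/2] i≢h))

2+nCk≤twoLayers : ∀ {n} k → 3 ≤ n → 2 + n C k ≤ twoLayers n
2+nCk≤twoLayers {n} k 3≤n = begin
  2 + n C k                      ≡⟨ +-comm 2 (n C k) ⟩
  n C k + 2                      ≤⟨ +-mono-≤ (nCk≤nC[n/2] n k) (2≤nCk z<s (1+n/2<n 3≤n)) ⟩
  n C (n / 2) + n C suc (n / 2)  ≡⟨ twoLayers≡ n ⟨
  twoLayers n                    ∎
  where open ≤-Reasoning

end-bound : ∀ {n a b r p m} → 3 ≤ n → r * p ≡ m → (n C a ≡ 1 × r ≡ 1) ⊎ (2 ≤ r × a ≢ b) →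
            2 * ((n C a) * p) + (n C b) * m ≤ twoLayers n * m
end-bound {n} {a} {b} {r} {p} {m} 3≤n r*p≡m (inj₁ (nCa≡1 , r≡1)) = begin
  2 * ((n C a) * p) + (n C b) * m  ≡⟨ cong (λ w → 2 * w + (n C b) * m) nCa*p≡m ⟩
  2 * m + (n C b) * m              ≡⟨ *-distribʳ-+ m 2 (n C b) ⟨
  (2 + n C b) * m                  ≤⟨ *-monoˡ-≤ m (2+nCk≤twoLayers b 3≤n) ⟩
  twoLayers n * m                  ∎
  where
  open ≤-Reasoning
  nCa*p≡m : (n C a) * p ≡ m
  nCa*p≡m = trans (cong (_* p) (trans nCa≡1 (sym r≡1))) r*p≡m
end-bound {n} {a} {b} {r} {p} {m} 3≤n r*p≡m (inj₂ (2≤r , a≢b)) = begin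
  2 * ((n C a) * p) + (n C b) * m  ≡⟨ cong (_+ (n C b) * m) (swap 2 (n C a) p) ⟩
  (n C a) * (2 * p) + (n C b) * m  ≤⟨ +-monoˡ-≤ ((n C b) * m) (*-monoʳ-≤ (n C a) 2*p≤m) ⟩
  (n C a) * m + (n C b) * m        ≡⟨ *-distribʳ-+ m (n C a) (n C b) ⟨
  (n C a + n C b) * m              ≤⟨ *-monoˡ-≤ m (nCi+nCj≤twoLayers a≢b) ⟩
  twoLayers n * m                  ∎
  where
  open ≤-Reasoning
  2*p≤m : 2 * p ≤ m
  2*p≤m = ≤-trans (*-monoˡ-≤ p 2≤r) (≤-reflexive r*p≡m)
  swap : ∀ x y z → x * (y * z) ≡ y * (x * z)
  swap = solve-∀

lower-end : ∀ {n a b} → a < b → (n C a ≡ 1 × b C a ≡ 1) ⊎ (2 ≤ b C a × a ≢ b)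
lower-end {n} {zero}  {b} _   = inj₁ (nC0≡1 n , nC0≡1 b)
lower-end {n} {suc a} {b} a<b = inj₂ (2≤nCk z<s a<b , <⇒≢ a<b)

upper-end : ∀ {n b d} → b < d → d ≤ n →
            (n C d ≡ 1 × (n ∸ b) C (d ∸ b) ≡ 1) ⊎ (2 ≤ (n ∸ b) C (d ∸ b) × d ≢ b)
upper-end {n} {b} {d} b<d d≤n with d ≟ n
... | yes refl = inj₁ (nCn≡1 d , nCn≡1 (d ∸ b))
... | no  d≢n  = inj₂ (2≤nCk (m<n⇒0<n∸m b<d) (∸-monoˡ-< (≤∧≢⇒< d≤n d≢n) (<⇒≤ b<d)) , >⇒≢ b<d)

-- Read m as the number of maximal chains through a set of size b, p as the number of those
-- that also pass through a given subset of size a, and q through a given superset of size d.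
middle-bound : ∀ {n a b d p m q} → 3 ≤ n → a < b → b < d → d ≤ n →
               (b C a) * p ≡ m → ((n ∸ b) C (d ∸ b)) * q ≡ m →
               (n C a) * p + (n C b) * m + (n C d) * q ≤ twoLayers n * m
middle-bound {n} {a} {b} {d} {p} {m} {q} 3≤n a<b b<d d≤n r*p≡m s*q≡m = *-cancelˡ-≤ 2 (begin
  2 * ((n C a) * p + (n C b) * m + (n C d) * q)
    ≡⟨ split ((n C a) * p) ((n C b) * m) ((n C d) * q) ⟩
  (2 * ((n C a) * p) + (n C b) * m) + (2 * ((n C d) * q) + (n C b) * m)
    ≤⟨ +-mono-≤ (end-bound 3≤n r*p≡m (lower-end a<b)) (end-bound 3≤n s*q≡m (upper-end b<d d≤n)) ⟩
  twoLayers n * m + twoLayers n * m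
    ≡⟨ double (twoLayers n * m) ⟩
  2 * (twoLayers n * m)
    ∎)
  where
  open ≤-Reasoning
  split : ∀ x y z → 2 * (x + y + z) ≡ (2 * x + y) + (2 * z + y)
  split = solve-∀
  double : ∀ x → x + x ≡ 2 * x
  double = solve-∀

-- Subsets

_≟ˢ_ : ∀ (X Y : Subset n) → Dec (X ≡ Y)
_≟ˢ_ = ≡-dec _≟ᵇ_

Empty⇒⊆ : ∀ {X Y : Subset n} → Empty X → X ⊆ Y
Empty⇒⊆ ∅X x∈X = contradiction (_ , x∈X) ∅X

∣Empty∣≡0 : ∀ {X : Subset n} → Empty X → ∣ X ∣ ≡ 0
∣Empty∣≡0 {n} ∅X = trans (cong ∣_∣ (Empty-unique ∅X)) (∣⊥∣≡0 n)

⊆∧≢⇒⊂ : ∀ {X Y : Subset n} → X ⊆ Y → X ≢ Y → X ⊂ Y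
⊆∧≢⇒⊂ {X = []}          {[]}          _   X≢Y = contradiction refl X≢Y
⊆∧≢⇒⊂ {X = outside ∷ X} {outside ∷ Y} X⊆Y X≢Y = out⊂ (⊆∧≢⇒⊂ (drop-∷-⊆ X⊆Y) (X≢Y ∘ cong (outside ∷_)))
⊆∧≢⇒⊂ {X = outside ∷ X} {inside  ∷ Y} X⊆Y _   = out⊂in (drop-∷-⊆ X⊆Y)
⊆∧≢⇒⊂ {X = inside  ∷ X} {outside ∷ Y} X⊆Y _   = contradiction (X⊆Y here) λ ()
⊆∧≢⇒⊂ {X = inside  ∷ X} {inside  ∷ Y} X⊆Y X≢Y = s⊂s (⊆∧≢⇒⊂ (drop-∷-⊆ X⊆Y) (X≢Y ∘ cong (inside ∷_)))

⊂⇒≢ : ∀ {X Y : Subset n} → X ⊂ Y → X ≢ Y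
⊂⇒≢ X⊂Y refl = ⊂-irref refl X⊂Y

∪⊆∩ : ∀ {A B C D : Subset n} → A ⊆ C → A ⊆ D → B ⊆ C → B ⊆ D → A ∪ B ⊆ C ∩ D
∪⊆∩ {A = A} {B} A⊆C A⊆D B⊆C B⊆D x∈A∪B with x∈p∪q⁻ A B x∈A∪B
... | inj₁ x∈A = x∈p∩q⁺ (A⊆C x∈A , A⊆D x∈A)
... | inj₂ x∈B = x∈p∩q⁺ (B⊆C x∈B , B⊆D x∈B)

⊆-removeAt : ∀ {X Y : Subset (suc n)} → X ⊆ Y → (x : Fin (suc n)) → removeAt X x ⊆ removeAt Y x
⊆-removeAt {X = _ ∷ _}           {_ ∷ _}           X⊆Y zero    = drop-∷-⊆ X⊆Y
⊆-removeAt {X = outside ∷ _ ∷ _} {_ ∷ _ ∷ _}       X⊆Y (suc x) = out⊆ (⊆-removeAt (drop-∷-⊆ X⊆Y) x)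
⊆-removeAt {X = inside  ∷ _ ∷ _} {inside  ∷ _ ∷ _} X⊆Y (suc x) = s⊆s (⊆-removeAt (drop-∷-⊆ X⊆Y) x)
⊆-removeAt {X = inside  ∷ _ ∷ _} {outside ∷ _ ∷ _} X⊆Y (suc x) = contradiction (X⊆Y here) λ ()

⊆-removeAt⁻ : ∀ {X Y : Subset (suc n)} {x} → x ∈ˢ Y → removeAt X x ⊆ removeAt Y x → X ⊆ Y
⊆-removeAt⁻ {X = _ ∷ _} {x = zero} here X′⊆Y′ here        = here
⊆-removeAt⁻ {X = _ ∷ _} {x = zero} here X′⊆Y′ (there y∈X) = there (X′⊆Y′ y∈X)
⊆-removeAt⁻ {X = outside ∷ _ ∷ _} {_ ∷ _ ∷ _}       {suc x} (there x∈Y) X′⊆Y′ =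
  out⊆ (⊆-removeAt⁻ x∈Y (drop-∷-⊆ X′⊆Y′))
⊆-removeAt⁻ {X = inside  ∷ _ ∷ _} {inside  ∷ _ ∷ _} {suc x} (there x∈Y) X′⊆Y′ =
  s⊆s (⊆-removeAt⁻ x∈Y (drop-∷-⊆ X′⊆Y′))
⊆-removeAt⁻ {X = inside  ∷ _ ∷ _} {outside ∷ _ ∷ _} {suc x} (there x∈Y) X′⊆Y′ =
  contradiction (X′⊆Y′ here) λ ()

∣X∣≡1+∣removeAt∣ : ∀ {X : Subset (suc n)} {x} → x ∈ˢ X → ∣ X ∣ ≡ suc ∣ removeAt X x ∣
∣X∣≡1+∣removeAt∣ {x = zero} here = refl
∣X∣≡1+∣removeAt∣ {X = inside  ∷ _ ∷ _} {suc x} (there x∈X) = cong suc (∣X∣≡1+∣removeAt∣ x∈X)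
∣X∣≡1+∣removeAt∣ {X = outside ∷ _ ∷ _} {suc x} (there x∈X) = ∣X∣≡1+∣removeAt∣ x∈X

T-lookup⇒∈ : ∀ {X : Subset n} {x} → T (lookup X x) → x ∈ˢ X
T-lookup⇒∈ {X = X} {x} t with lookup X x in eq
... | true = lookup⇒[]= x X eq

∈⇒T-lookup : ∀ {X : Subset n} {x} → x ∈ˢ X → T (lookup X x)
∈⇒T-lookup x∈X = subst T (sym ([]=⇒lookup x∈X)) _

∑-lookup : ∀ (X : Subset n) (f : Fin n → ℕ) {k} → (∀ {x} → x ∈ˢ X → f x ≡ k) →
           ∑[ x ← allFin n ] (⟦ lookup X x ⟧ * f x) ≡ ∣ X ∣ * k
∑-lookup []            f f≡k = refl
∑-lookup (inside ∷ X)  f f≡k = trans (∑-allFin-suc (λ x → ⟦ lookup (inside ∷ X) x ⟧ * f x))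
                                     (cong₂ _+_ (trans (+-identityʳ (f zero)) (f≡k here)) (∑-lookup X (f ∘ suc) (f≡k ∘ there)))
∑-lookup (outside ∷ X) f f≡k = trans (∑-allFin-suc (λ x → ⟦ lookup (outside ∷ X) x ⟧ * f x))
                                     (∑-lookup X (f ∘ suc) (f≡k ∘ there))

-- Maximal chains

-- A maximal chain ∅ ⊂ {x₁} ⊂ {x₁, x₂} ⊂ ⋯ of subsets of Fin n is given by its first point x₁
-- and a maximal chain of the remaining n − 1 points, indexed as in removeAt _ x₁.
Chain : ℕ → Set
Chain zero    = ⊤
Chain (suc n) = Fin (suc n) × Chain n

chains : ∀ n → List (Chain n)
chains zero    = [ tt ]
chains (suc n) = cartesianProduct (allFin (suc n)) (chains n)

through : Chain n → Subset n → Bool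
through {zero}  _       _ = true
through {suc n} (x , c) X = if isYes (nonempty? X) then lookup X x ∧ through c (removeAt X x) else true

∑-chains-const : ∀ n k → ∑[ _ ← chains n ] k ≡ n ! * k
∑-chains-const zero    k = refl
∑-chains-const (suc n) k = begin
  ∑[ _ ← chains (suc n) ] k                    ≡⟨ ∑-cartesianProduct (allFin (suc n)) (chains n) _ ⟩
  ∑[ _ ← allFin (suc n) ] ∑[ _ ← chains n ] k  ≡⟨ ∑-cong (allFin (suc n)) (λ _ → ∑-chains-const n k) ⟩
  ∑[ _ ← allFin (suc n) ] (n ! * k)            ≡⟨ ∑-const (allFin (suc n)) (n ! * k) ⟩
  length (allFin (suc n)) * (n ! * k)          ≡⟨ cong (_* (n ! * k)) (length-tabulate {n = suc n} id) ⟩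
  suc n * (n ! * k)                            ≡⟨ *-assoc (suc n) (n !) k ⟨
  suc n ! * k                                  ∎
  where open ≡-Reasoning

through-empty : ∀ {X : Subset n} (c : Chain n) → Empty X → through c X ≡ true
through-empty {zero}  _ _ = refl
through-empty {suc n} {X} (x , c) ∅X with nonempty? X
... | yes neX = contradiction neX ∅X
... | no  _   = refl

through-nonempty : ∀ {X : Subset (suc n)} (x : Fin (suc n)) (c : Chain n) → Nonempty X →
                   through (x , c) X ≡ lookup X x ∧ through c (removeAt X x)
through-nonempty {X = X} x c neX with nonempty? X
... | yes _  = refl
... | no  ∅X = contradiction neX ∅X

through-⊆-total : ∀ {X Y : Subset n} (c : Chain n) → T (through c X) → T (through c Y) → X ⊆ Y ⊎ Y ⊆ X
through-⊆-total {zero}  {[]} {[]} _ _ _ = inj₁ id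
through-⊆-total {suc n} {X}  {Y}  (x , c) onX onY with nonempty? X | nonempty? Y
... | no  ∅X | _     = inj₁ (Empty⇒⊆ ∅X)
... | yes _  | no ∅Y = inj₂ (Empty⇒⊆ ∅Y)
... | yes _  | yes _ with T-∧ .to onX | T-∧ .to onY
...   | x∈X , onX′ | x∈Y , onY′ =
  Sum.map (⊆-removeAt⁻ (T-lookup⇒∈ x∈Y)) (⊆-removeAt⁻ (T-lookup⇒∈ x∈X)) (through-⊆-total c onX′ onY′)

through-⊂-total : ∀ {X Y : Subset n} (c : Chain n) → T (through c X) → T (through c Y) → X ≢ Y →
                  X ⊂ Y ⊎ Y ⊂ X
through-⊂-total c onX onY X≢Y with through-⊆-total c onX onY
... | inj₁ X⊆Y = inj₁ (⊆∧≢⇒⊂ X⊆Y X≢Y)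
... | inj₂ Y⊆X = inj₂ (⊆∧≢⇒⊂ Y⊆X (X≢Y ∘ sym))

through-∣∣-injective : ∀ {X Y : Subset n} (c : Chain n) → T (through c X) → T (through c Y) →
                       ∣ X ∣ ≡ ∣ Y ∣ → X ≡ Y
through-∣∣-injective {X = X} {Y} c onX onY ∣X∣≡∣Y∣ with X ≟ˢ Y
... | yes X≡Y = X≡Y
... | no  X≢Y with through-⊂-total c onX onY X≢Y
...   | inj₁ X⊂Y = contradiction ∣X∣≡∣Y∣ (<⇒≢ (p⊂q⇒∣p∣<∣q∣ X⊂Y))
...   | inj₂ Y⊂X = contradiction (sym ∣X∣≡∣Y∣) (<⇒≢ (p⊂q⇒∣p∣<∣q∣ Y⊂X))

chainsThrough : Subset n → ℕ
chainsThrough {n} X = ∑[ c ← chains n ] ⟦ through c X ⟧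

chainsThrough₂ : Subset n → Subset n → ℕ
chainsThrough₂ {n} X Y = ∑[ c ← chains n ] (⟦ through c X ⟧ * ⟦ through c Y ⟧)

chainsThrough≡chainsThrough₂ : ∀ (X : Subset n) → chainsThrough X ≡ chainsThrough₂ X X
chainsThrough≡chainsThrough₂ {n} X = ∑-cong (chains n) (λ {c} _ → sym (⟦b⟧*⟦b⟧≡⟦b⟧ (through c X)))

chainsThrough₂-empty : ∀ {X Y : Subset n} → Empty X → chainsThrough₂ X Y ≡ chainsThrough Y
chainsThrough₂-empty {n} {X} {Y} ∅X = ∑-cong (chains n) λ {c} _ →
  trans (cong (λ b → ⟦ b ⟧ * ⟦ through c Y ⟧) (through-empty c ∅X)) (+-identityʳ _)

chainsThrough₂≡∣X∣!*[∣Y∣∸∣X∣]!*[n∸∣Y∣]! :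
  ∀ {n} {X Y : Subset n} → X ⊆ Y → chainsThrough₂ X Y ≡ ∣ X ∣ ! * (∣ Y ∣ ∸ ∣ X ∣) ! * (n ∸ ∣ Y ∣) !
chainsThrough₂-nonempty : ∀ {X Y : Subset (suc n)} → X ⊆ Y → Nonempty X →
                          chainsThrough₂ X Y ≡ ∣ X ∣ ! * (∣ Y ∣ ∸ ∣ X ∣) ! * (suc n ∸ ∣ Y ∣) !

chainsThrough₂≡∣X∣!*[∣Y∣∸∣X∣]!*[n∸∣Y∣]! {zero}  {[]} {[]} _ = refl
chainsThrough₂≡∣X∣!*[∣Y∣∸∣X∣]!*[n∸∣Y∣]! {suc n} {X}  {Y}  X⊆Y = by-cases (nonempty? X) (nonempty? Y)
  where
  open ≡-Reasoning
  by-cases : Dec (Nonempty X) → Dec (Nonempty Y) →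
             chainsThrough₂ X Y ≡ ∣ X ∣ ! * (∣ Y ∣ ∸ ∣ X ∣) ! * (suc n ∸ ∣ Y ∣) !
  by-cases (yes neX) _ = chainsThrough₂-nonempty X⊆Y neX
  by-cases (no ∅X) (yes neY) rewrite ∣Empty∣≡0 ∅X = begin
    chainsThrough₂ X Y                               ≡⟨ chainsThrough₂-empty {Y = Y} ∅X ⟩
    chainsThrough Y                                  ≡⟨ chainsThrough≡chainsThrough₂ Y ⟩
    chainsThrough₂ Y Y                               ≡⟨ chainsThrough₂-nonempty id neY ⟩
    ∣ Y ∣ ! * (∣ Y ∣ ∸ ∣ Y ∣) ! * (suc n ∸ ∣ Y ∣) !  ≡⟨ cong (λ m → ∣ Y ∣ ! * m ! * r) (n∸n≡0 ∣ Y ∣) ⟩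
    ∣ Y ∣ ! * 1 * (suc n ∸ ∣ Y ∣) !                  ≡⟨ cong (_* (suc n ∸ ∣ Y ∣) !) y!*1≡1*y! ⟩
    1 * ∣ Y ∣ ! * (suc n ∸ ∣ Y ∣) !                  ∎
    where
    r = (suc n ∸ ∣ Y ∣) !
    y!*1≡1*y! : ∣ Y ∣ ! * 1 ≡ 1 * ∣ Y ∣ !
    y!*1≡1*y! = trans (*-identityʳ (∣ Y ∣ !)) (sym (+-identityʳ (∣ Y ∣ !)))
  by-cases (no ∅X) (no ∅Y) rewrite ∣Empty∣≡0 ∅X | ∣Empty∣≡0 ∅Y = begin
    chainsThrough₂ X Y          ≡⟨ chainsThrough₂-empty {Y = Y} ∅X ⟩
    chainsThrough Y             ≡⟨ ∑-cong (chains (suc n)) (λ {c} _ → cong ⟦_⟧ (through-empty {X = Y} c ∅Y)) ⟩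
    ∑[ _ ← chains (suc n) ] 1  ≡⟨ ∑-chains-const (suc n) 1 ⟩
    suc n ! * 1                 ≡⟨ *-identityʳ _ ⟩
    suc n !                     ≡⟨ +-identityʳ _ ⟨
    1 * 1 * suc n !             ∎

chainsThrough₂-nonempty {n} {X} {Y} X⊆Y (x₀ , x₀∈X) = begin
  chainsThrough₂ X Y
    ≡⟨ ∑-cartesianProduct (allFin (suc n)) (chains n) _ ⟩
  ∑[ x ← allFin (suc n) ] ∑[ c ← chains n ] (⟦ through (x , c) X ⟧ * ⟦ through (x , c) Y ⟧)
    ≡⟨ ∑-cong (allFin (suc n)) (λ {x} _ → first-point x) ⟩
  ∑[ x ← allFin (suc n) ] (⟦ lookup X x ⟧ * chainsThrough₂ (removeAt X x) (removeAt Y x))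
    ≡⟨ ∑-lookup X _ (λ x∈X → trans (chainsThrough₂≡∣X∣!*[∣Y∣∸∣X∣]!*[n∸∣Y∣]! (⊆-removeAt X⊆Y _))
                                    (cong₂ (λ a b → a ! * (b ∸ a) ! * (n ∸ b) !)
                                           (∣removeAt∣ x∈X x₀∈X) (∣removeAt∣ (X⊆Y x∈X) (X⊆Y x₀∈X)))) ⟩
  ∣ X ∣ * (a ! * (b ∸ a) ! * (n ∸ b) !)
    ≡⟨ cong (_* (a ! * (b ∸ a) ! * (n ∸ b) !)) (∣X∣≡1+∣removeAt∣ x₀∈X) ⟩
  suc a * (a ! * (b ∸ a) ! * (n ∸ b) !)
    ≡⟨ reassociate (suc a) (a !) ((b ∸ a) !) ((n ∸ b) !) ⟩
  suc a ! * (suc b ∸ suc a) ! * (suc n ∸ suc b) !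
    ≡⟨ cong₂ (λ a b → a ! * (b ∸ a) ! * (suc n ∸ b) !)
             (∣X∣≡1+∣removeAt∣ x₀∈X) (∣X∣≡1+∣removeAt∣ (X⊆Y x₀∈X)) ⟨
  ∣ X ∣ ! * (∣ Y ∣ ∸ ∣ X ∣) ! * (suc n ∸ ∣ Y ∣) !
    ∎
  where
  open ≡-Reasoning
  a = ∣ removeAt X x₀ ∣
  b = ∣ removeAt Y x₀ ∣
  ∣removeAt∣ : ∀ {Z : Subset (suc n)} {x y} → x ∈ˢ Z → y ∈ˢ Z → ∣ removeAt Z x ∣ ≡ ∣ removeAt Z y ∣
  ∣removeAt∣ x∈Z y∈Z = suc-injective (trans (sym (∣X∣≡1+∣removeAt∣ x∈Z)) (∣X∣≡1+∣removeAt∣ y∈Z))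
  reassociate : ∀ s f p q → s * (f * p * q) ≡ s * f * p * q
  reassociate = solve-∀
  first-point : ∀ x → ∑[ c ← chains n ] (⟦ through (x , c) X ⟧ * ⟦ through (x , c) Y ⟧)
                    ≡ ⟦ lookup X x ⟧ * chainsThrough₂ (removeAt X x) (removeAt Y x)
  first-point x = begin
    ∑[ c ← chains n ] (⟦ through (x , c) X ⟧ * ⟦ through (x , c) Y ⟧)
      ≡⟨ ∑-cong (chains n) (λ {c} _ → trans
           (cong₂ (λ s t → ⟦ s ⟧ * ⟦ t ⟧) (through-nonempty x c (x₀ , x₀∈X))
                                         (through-nonempty x c (x₀ , X⊆Y x₀∈X)))
           (⟦p∧s⟧*⟦q∧t⟧≡⟦p⟧*[⟦s⟧*⟦t⟧] _ _ (∈⇒T-lookup ∘ X⊆Y ∘ T-lookup⇒∈))) ⟩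
    ∑[ c ← chains n ] (⟦ lookup X x ⟧ * (⟦ through c (removeAt X x) ⟧ * ⟦ through c (removeAt Y x) ⟧))
      ≡⟨ ∑-distribˡ-* (chains n) ⟦ lookup X x ⟧ _ ⟩
    ⟦ lookup X x ⟧ * chainsThrough₂ (removeAt X x) (removeAt Y x)
      ∎

chainsThrough≡∣X∣!*[n∸∣X∣]! : ∀ (X : Subset n) → chainsThrough X ≡ ∣ X ∣ ! * (n ∸ ∣ X ∣) !
chainsThrough≡∣X∣!*[n∸∣X∣]! {n} X = begin
  chainsThrough X                              ≡⟨ chainsThrough≡chainsThrough₂ X ⟩
  chainsThrough₂ X X                           ≡⟨ chainsThrough₂≡∣X∣!*[∣Y∣∸∣X∣]!*[n∸∣Y∣]! {X = X} id ⟩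
  ∣ X ∣ ! * (∣ X ∣ ∸ ∣ X ∣) ! * (n ∸ ∣ X ∣) !  ≡⟨ cong (λ m → ∣ X ∣ ! * m ! * (n ∸ ∣ X ∣) !) (n∸n≡0 ∣ X ∣) ⟩
  ∣ X ∣ ! * 1 * (n ∸ ∣ X ∣) !                  ≡⟨ cong (_* (n ∸ ∣ X ∣) !) (*-identityʳ (∣ X ∣ !)) ⟩
  ∣ X ∣ ! * (n ∸ ∣ X ∣) !                      ∎
  where open ≡-Reasoning

nC∣X∣*chainsThrough≡n! : ∀ (X : Subset n) → (n C ∣ X ∣) * chainsThrough X ≡ n !
nC∣X∣*chainsThrough≡n! {n} X =
  trans (cong ((n C ∣ X ∣) *_) (chainsThrough≡∣X∣!*[n∸∣X∣]! X)) (nCk*[k!*[n∸k]!]≡n! (∣p∣≤n X))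

∣Y∣C∣X∣*chainsThrough₂≡chainsThrough : ∀ {X Y : Subset n} → X ⊆ Y →
                                       (∣ Y ∣ C ∣ X ∣) * chainsThrough₂ X Y ≡ chainsThrough Y
∣Y∣C∣X∣*chainsThrough₂≡chainsThrough {n} {X} {Y} X⊆Y = begin
  (y C x) * chainsThrough₂ X Y             ≡⟨ cong ((y C x) *_) (chainsThrough₂≡∣X∣!*[∣Y∣∸∣X∣]!*[n∸∣Y∣]! X⊆Y) ⟩
  (y C x) * (x ! * (y ∸ x) ! * (n ∸ y) !)  ≡⟨ reassociate (y C x) (x !) ((y ∸ x) !) ((n ∸ y) !) ⟩
  (y C x) * (x ! * (y ∸ x) !) * (n ∸ y) !  ≡⟨ cong (_* (n ∸ y) !) (nCk*[k!*[n∸k]!]≡n! (p⊆q⇒∣p∣≤∣q∣ X⊆Y)) ⟩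
  y ! * (n ∸ y) !                          ≡⟨ chainsThrough≡∣X∣!*[n∸∣X∣]! Y ⟨
  chainsThrough Y                          ∎
  where
  open ≡-Reasoning
  x = ∣ X ∣
  y = ∣ Y ∣
  reassociate : ∀ c p q r → c * (p * q * r) ≡ c * (p * q) * r
  reassociate = solve-∀

[n∸∣X∣]C[∣Y∣∸∣X∣]*chainsThrough₂≡chainsThrough : ∀ {X Y : Subset n} → X ⊆ Y →
  ((n ∸ ∣ X ∣) C (∣ Y ∣ ∸ ∣ X ∣)) * chainsThrough₂ X Y ≡ chainsThrough X
[n∸∣X∣]C[∣Y∣∸∣X∣]*chainsThrough₂≡chainsThrough {n} {X} {Y} X⊆Y = begin
  (m C k) * chainsThrough₂ X Y         ≡⟨ cong ((m C k) *_) (chainsThrough₂≡∣X∣!*[∣Y∣∸∣X∣]!*[n∸∣Y∣]! X⊆Y) ⟩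
  (m C k) * (x ! * k ! * (n ∸ y) !)    ≡⟨ cong (λ z → (m C k) * (x ! * k ! * z !)) n∸y≡m∸k ⟩
  (m C k) * (x ! * k ! * (m ∸ k) !)    ≡⟨ reassociate (m C k) (x !) (k !) ((m ∸ k) !) ⟩
  x ! * ((m C k) * (k ! * (m ∸ k) !))  ≡⟨ cong (x ! *_) (nCk*[k!*[n∸k]!]≡n! (∸-monoˡ-≤ x (∣p∣≤n Y))) ⟩
  x ! * m !                            ≡⟨ chainsThrough≡∣X∣!*[n∸∣X∣]! X ⟨
  chainsThrough X                      ∎
  where
  open ≡-Reasoning
  x = ∣ X ∣
  y = ∣ Y ∣
  m = n ∸ x
  k = y ∸ x
  n∸y≡m∸k : n ∸ y ≡ m ∸ k
  n∸y≡m∸k = sym (trans (∸-+-assoc n x k) (cong (n ∸_) (m+[n∸m]≡n (p⊆q⇒∣p∣≤∣q∣ X⊆Y))))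
  reassociate : ∀ c p q r → c * (p * q * r) ≡ p * (c * (q * r))
  reassociate = solve-∀

-- Butterfly-free families

module ButterflyFree {F : List (Subset n)} (unique : Unique F) (forbidden : Forbidden F) where

  butterfly : ∀ {A B C D} → A ∈ F → B ∈ F → C ∈ F → D ∈ F → A ≢ B → C ≢ D →
              A ⊂ C → A ⊂ D → B ⊂ C → B ⊂ D → ⊥
  butterfly a b c d A≢B C≢D A⊂C A⊂D B⊂C B⊂D =
    forbidden _ _ _ _ a b c d A≢B (⊂⇒≢ A⊂C) (⊂⇒≢ A⊂D) (⊂⇒≢ B⊂C) (⊂⇒≢ B⊂D) C≢D
              (∪⊆∩ (proj₁ A⊂C) (proj₁ A⊂D) (proj₁ B⊂C) (proj₁ B⊂D))

  no-4-chain : ∀ {W X Y Z} → W ∈ F → X ∈ F → Y ∈ F → Z ∈ F → W ⊂ X → X ⊂ Y → Y ⊂ Z → ⊥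
  no-4-chain w x y z W⊂X X⊂Y Y⊂Z =
    butterfly w x y z (⊂⇒≢ W⊂X) (⊂⇒≢ Y⊂Z) (⊂-trans W⊂X X⊂Y) (⊂-trans W⊂X X⊂Z) X⊂Y X⊂Z
    where X⊂Z = ⊂-trans X⊂Y Y⊂Z

  Middle : Subset n → Set
  Middle B = Any (_⊂ B) F × Any (B ⊂_) F

  middle? : Decidable Middle
  middle? B = any? (_⊂? B) F ×-dec any? (B ⊂?_) F

  isMiddle : Subset n → Bool
  isMiddle B = isYes (middle? B)

  middle-of : ∀ {A B D} → A ∈ F → D ∈ F → A ⊂ B → B ⊂ D → Middle B
  middle-of a d A⊂B B⊂D = lose a A⊂B , lose d B⊂D

  below-unique : ∀ {A A′ B D} → A ∈ F → A′ ∈ F → B ∈ F → D ∈ F →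
                 A ⊂ B → B ⊂ D → A′ ⊂ B → A′ ≡ A
  below-unique {A} {A′} a a′ b d A⊂B B⊂D A′⊂B with A′ ≟ˢ A
  ... | yes A′≡A = A′≡A
  ... | no  A′≢A =
    ⊥-elim (butterfly a′ a b d A′≢A (⊂⇒≢ B⊂D) A′⊂B (⊂-trans A′⊂B B⊂D) A⊂B (⊂-trans A⊂B B⊂D))

  above-unique : ∀ {A B D D′} → A ∈ F → B ∈ F → D ∈ F → D′ ∈ F →
                 A ⊂ B → B ⊂ D → B ⊂ D′ → D′ ≡ D
  above-unique {D = D} {D′} a b d d′ A⊂B B⊂D B⊂D′ with D′ ≟ˢ D
  ... | yes D′≡D = D′≡D
  ... | no  D′≢D =
    ⊥-elim (butterfly a b d′ d (⊂⇒≢ A⊂B) D′≢D (⊂-trans A⊂B B⊂D′) (⊂-trans A⊂B B⊂D) B⊂D′ B⊂D)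

  middle-⊂-middle : ∀ {B B′} → B ∈ F → B′ ∈ F → Middle B → Middle B′ → ¬ B ⊂ B′
  middle-⊂-middle b b′ (below , _) (_ , above) B⊂B′ with find below | find above
  ... | _ , a , A⊂B | _ , d , B′⊂D = no-4-chain a b b′ d A⊂B B⊂B′ B′⊂D

  weight : Subset n → ℕ
  weight X = n C ∣ X ∣

  load : Chain n → ℕ
  load c = ∑[ X ← F ] (weight X * ⟦ through c X ⟧)

  middles : Chain n → ℕ
  middles c = ∑[ B ← F ] (⟦ isMiddle B ⟧ * ⟦ through c B ⟧)

  middles≤1 : ∀ c → middles c ≤ 1
  middles≤1 c = begin
    middles c                                ≡⟨ ∑-cong F (λ {B} _ → ⟦∧⟧ (isMiddle B) (through c B)) ⟨
    ∑[ B ← F ] ⟦ isMiddle B ∧ through c B ⟧  ≤⟨ ∑-indicator≤1 (λ B → isMiddle B ∧ through c B) unique at-most-one ⟩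
    1                                        ∎
    where
    open ≤-Reasoning
    at-most-one : ∀ {B B′} → B ∈ F → B′ ∈ F →
                  T (isMiddle B ∧ through c B) → T (isMiddle B′ ∧ through c B′) → B ≡ B′
    at-most-one {B} {B′} b b′ mB mB′ with T-∧ .to mB | T-∧ .to mB′ | B ≟ˢ B′
    ... | _ | _ | yes B≡B′ = B≡B′
    ... | m , onB | m′ , onB′ | no B≢B′ with through-⊂-total c onB onB′ B≢B′
    ...   | inj₁ B⊂B′ = ⊥-elim (middle-⊂-middle b b′ (toWitness m) (toWitness m′) B⊂B′)
    ...   | inj₂ B′⊂B = ⊥-elim (middle-⊂-middle b′ b (toWitness m′) (toWitness m) B′⊂B)

  middle-of-three : ∀ c {X Y Z} → X ∈ F → Y ∈ F → Z ∈ F →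
                    T (through c X) → T (through c Y) → T (through c Z) → X ≢ Y → X ≢ Z → Y ≢ Z →
                    Middle X ⊎ Middle Y ⊎ Middle Z
  middle-of-three c x y z onX onY onZ X≢Y X≢Z Y≢Z
    with through-⊂-total c onX onY X≢Y | through-⊂-total c onY onZ Y≢Z | through-⊂-total c onX onZ X≢Z
  ... | inj₁ X⊂Y | inj₁ Y⊂Z | _         = inj₂ (inj₁ (middle-of x z X⊂Y Y⊂Z))
  ... | inj₁ X⊂Y | inj₂ Z⊂Y | inj₁ X⊂Z = inj₂ (inj₂ (middle-of x y X⊂Z Z⊂Y))
  ... | inj₁ X⊂Y | inj₂ Z⊂Y | inj₂ Z⊂X = inj₁ (middle-of z y Z⊂X X⊂Y)
  ... | inj₂ Y⊂X | inj₁ Y⊂Z | inj₁ X⊂Z = inj₁ (middle-of y z Y⊂X X⊂Z)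
  ... | inj₂ Y⊂X | inj₁ Y⊂Z | inj₂ Z⊂X = inj₂ (inj₂ (middle-of y x Y⊂Z Z⊂X))
  ... | inj₂ Y⊂X | inj₂ Z⊂Y | _         = inj₂ (inj₁ (middle-of z x Z⊂Y Y⊂X))

  load-without-middle : ∀ c → (∀ {B} → B ∈ F → Middle B → ¬ T (through c B)) → load c ≤ twoLayers n
  load-without-middle c no-middle = begin
    load c                                   ≡⟨ ∑-cong F (λ {X} _ → *-comm (weight X) _) ⟩
    ∑[ X ← F ] (⟦ through c X ⟧ * weight X)  ≡⟨ ∑-filter (through c) F weight ⟨
    ∑ (filter (T? ∘ through c) F) weight     ≤⟨ at-most-two (filter⁺ (T? ∘ through c) unique)
                                                            (∈-filter⁻ (T? ∘ through c)) ⟩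
    twoLayers n                              ∎
    where
    open ≤-Reasoning
    at-most-two : ∀ {K} → Unique K → (∀ {X} → X ∈ K → X ∈ F × T (through c X)) → ∑ K weight ≤ twoLayers n
    at-most-two {[]}         _ _ = z≤n
    at-most-two {X ∷ []}     _ _ = ≤-trans (≤-reflexive (+-identityʳ (weight X))) (nCk≤twoLayers n ∣ X ∣)
    at-most-two {X ∷ Y ∷ []} ((X≢Y ∷ []) ∷ _) on-K =
      ≤-trans (≤-reflexive (cong (weight X +_) (+-identityʳ (weight Y))))
              (nCi+nCj≤twoLayers (X≢Y ∘ through-∣∣-injective c (proj₂ (on-K (here refl)))
                                                               (proj₂ (on-K (there (here refl))))))
    at-most-two {X ∷ Y ∷ Z ∷ _} ((X≢Y ∷ X≢Z ∷ _) ∷ (Y≢Z ∷ _) ∷ _) on-K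
      with on-K (here refl) | on-K (there (here refl)) | on-K (there (there (here refl)))
    ... | x , onX | y , onY | z , onZ with middle-of-three c x y z onX onY onZ X≢Y X≢Z Y≢Z
    ...   | inj₁ mX        = contradiction onX (no-middle x mX)
    ...   | inj₂ (inj₁ mY) = contradiction onY (no-middle y mY)
    ...   | inj₂ (inj₂ mZ) = contradiction onZ (no-middle z mZ)

  on-middle-chain : ∀ c {A B D X} → A ∈ F → B ∈ F → D ∈ F → A ⊂ B → B ⊂ D → T (through c B) →
                    X ∈ F → T (through c X) → X ≡ A ⊎ X ≡ B ⊎ X ≡ D
  on-middle-chain c {B = B} {X = X} a b d A⊂B B⊂D onB x onX with X ≟ˢ B
  ... | yes X≡B = inj₂ (inj₁ X≡B)
  ... | no  X≢B with through-⊂-total c onX onB X≢B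
  ...   | inj₁ X⊂B = inj₁ (below-unique a x b d A⊂B B⊂D X⊂B)
  ...   | inj₂ B⊂X = inj₂ (inj₂ (above-unique a b d x A⊂B B⊂D B⊂X))

  load-through-middle : ∀ c {A B D} → A ∈ F → B ∈ F → D ∈ F → A ⊂ B → B ⊂ D → T (through c B) →
    load c ≤ weight A * ⟦ through c A ⟧ + weight B * ⟦ through c B ⟧ + weight D * ⟦ through c D ⟧
  load-through-middle c {A} {B} {D} a b d A⊂B B⊂D onB = begin
    load c
      ≤⟨ ∑-mono F pointwise ⟩
    ∑[ X ← F ] (≟A X * g A + ≟B X * g B + ≟D X * g D)
      ≡⟨ ∑-distrib-+ F _ _ ⟩
    ∑[ X ← F ] (≟A X * g A + ≟B X * g B) + ∑[ X ← F ] (≟D X * g D)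
      ≡⟨ cong (_+ ∑[ X ← F ] (≟D X * g D)) (∑-distrib-+ F _ _) ⟩
    ∑[ X ← F ] (≟A X * g A) + ∑[ X ← F ] (≟B X * g B) + ∑[ X ← F ] (≟D X * g D)
      ≤⟨ +-mono-≤ (+-mono-≤ (∑-≟-≤ _≟ˢ_ A (g A) unique) (∑-≟-≤ _≟ˢ_ B (g B) unique))
                  (∑-≟-≤ _≟ˢ_ D (g D) unique) ⟩
    g A + g B + g D
      ∎
    where
    open ≤-Reasoning
    g : Subset n → ℕ
    g X = weight X * ⟦ through c X ⟧
    ≟A ≟B ≟D : Subset n → ℕ
    ≟A X = ⟦ isYes (X ≟ˢ A) ⟧
    ≟B X = ⟦ isYes (X ≟ˢ B) ⟧
    ≟D X = ⟦ isYes (X ≟ˢ D) ⟧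
    counted : ∀ Y → g Y ≤ ⟦ isYes (Y ≟ˢ Y) ⟧ * g Y
    counted Y rewrite ≡-≟-identity _≟ˢ_ (refl {x = Y}) = ≤-reflexive (sym (+-identityʳ (g Y)))
    pointwise : ∀ {X} → X ∈ F → g X ≤ ≟A X * g A + ≟B X * g B + ≟D X * g D
    pointwise {X} x with T? (through c X)
    ... | no ¬onX = ≤-trans (≤-reflexive (trans (cong (weight X *_) (¬T⇒⟦⟧≡0 ¬onX)) (*-zeroʳ (weight X)))) z≤n
    ... | yes onX with on-middle-chain c a b d A⊂B B⊂D onB x onX
    ...   | inj₁ refl        = ≤-trans (counted A) (≤-trans (m≤m+n _ (≟B A * g B)) (m≤m+n _ (≟D A * g D)))
    ...   | inj₂ (inj₁ refl) = ≤-trans (counted B) (≤-trans (m≤n+m _ (≟A B * g A)) (m≤m+n _ (≟D B * g D)))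
    ...   | inj₂ (inj₂ refl) = ≤-trans (counted D) (m≤n+m _ (≟A D * g A + ≟B D * g B))

  ∑-load-through-middle : 3 ≤ n → ∀ {B} → B ∈ F → Middle B →
                          ∑[ c ← chains n ] (⟦ through c B ⟧ * load c) ≤ twoLayers n * chainsThrough B
  ∑-load-through-middle 3≤n {B} b (below , above) with find below | find above
  ... | A , a , A⊂B | D , d , B⊂D = begin
    ∑[ c ← chains n ] (⟦ t c B ⟧ * load c)
      ≤⟨ ∑-mono (chains n) (λ {c} _ → ⟦⟧*-monoʳ-≤ (t c B) (load-through-middle c a b d A⊂B B⊂D)) ⟩
    ∑[ c ← chains n ] (⟦ t c B ⟧ * (wA * ⟦ t c A ⟧ + wB * ⟦ t c B ⟧ + wD * ⟦ t c D ⟧))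
      ≡⟨ ∑-cong (chains n) (λ {c} _ → distribute wA wB wD ⟦ t c A ⟧ ⟦ t c B ⟧ ⟦ t c D ⟧) ⟩
    ∑[ c ← chains n ] (wA * (⟦ t c A ⟧ * ⟦ t c B ⟧) + wB * (⟦ t c B ⟧ * ⟦ t c B ⟧) + wD * (⟦ t c B ⟧ * ⟦ t c D ⟧))
      ≡⟨ ∑-distrib-+ (chains n) _ _ ⟩
    ∑[ c ← chains n ] (wA * (⟦ t c A ⟧ * ⟦ t c B ⟧) + wB * (⟦ t c B ⟧ * ⟦ t c B ⟧))
      + ∑[ c ← chains n ] (wD * (⟦ t c B ⟧ * ⟦ t c D ⟧))
      ≡⟨ cong (_+ ∑[ c ← chains n ] (wD * (⟦ t c B ⟧ * ⟦ t c D ⟧))) (∑-distrib-+ (chains n) _ _) ⟩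
    ∑[ c ← chains n ] (wA * (⟦ t c A ⟧ * ⟦ t c B ⟧)) + ∑[ c ← chains n ] (wB * (⟦ t c B ⟧ * ⟦ t c B ⟧))
      + ∑[ c ← chains n ] (wD * (⟦ t c B ⟧ * ⟦ t c D ⟧))
      ≡⟨ cong₂ _+_ (cong₂ _+_ (∑-distribˡ-* (chains n) wA _) (∑-distribˡ-* (chains n) wB _))
                   (∑-distribˡ-* (chains n) wD _) ⟩
    wA * chainsThrough₂ A B + wB * chainsThrough₂ B B + wD * chainsThrough₂ B D
      ≡⟨ cong (λ m → wA * chainsThrough₂ A B + wB * m + wD * chainsThrough₂ B D)
              (chainsThrough≡chainsThrough₂ B) ⟨
    wA * chainsThrough₂ A B + wB * chainsThrough B + wD * chainsThrough₂ B D
      ≤⟨ middle-bound 3≤n (p⊂q⇒∣p∣<∣q∣ A⊂B) (p⊂q⇒∣p∣<∣q∣ B⊂D) (∣p∣≤n D)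
                      (∣Y∣C∣X∣*chainsThrough₂≡chainsThrough (p⊂q⇒p⊆q A⊂B))
                      ([n∸∣X∣]C[∣Y∣∸∣X∣]*chainsThrough₂≡chainsThrough (p⊂q⇒p⊆q B⊂D)) ⟩
    twoLayers n * chainsThrough B
      ∎
    where
    open ≤-Reasoning
    t = through
    wA = weight A
    wB = weight B
    wD = weight D
    distribute : ∀ a b d x y z → y * (a * x + b * y + d * z) ≡ a * (x * y) + b * (y * y) + d * (y * z)
    distribute = solve-∀

  ∑-load : ∑[ c ← chains n ] load c ≡ length F * n !
  ∑-load = begin
    ∑[ c ← chains n ] ∑[ X ← F ] (weight X * ⟦ through c X ⟧)  ≡⟨ ∑-comm (chains n) F _ ⟩
    ∑[ X ← F ] ∑[ c ← chains n ] (weight X * ⟦ through c X ⟧)  ≡⟨ ∑-cong F (λ {X} _ → weighted-count X) ⟩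
    ∑[ X ← F ] (n !)                                           ≡⟨ ∑-const F (n !) ⟩
    length F * n !                                             ∎
    where
    open ≡-Reasoning
    weighted-count : ∀ X → ∑[ c ← chains n ] (weight X * ⟦ through c X ⟧) ≡ n !
    weighted-count X = trans (∑-distribˡ-* (chains n) (weight X) _) (nC∣X∣*chainsThrough≡n! X)

  middleMass : ℕ
  middleMass = ∑[ B ← F ] (⟦ isMiddle B ⟧ * chainsThrough B)

  ∑-middles : ∑[ c ← chains n ] middles c ≡ middleMass
  ∑-middles = trans (∑-comm (chains n) F _) (∑-cong F (λ {B} _ → ∑-distribˡ-* (chains n) ⟦ isMiddle B ⟧ _))

  ∑-middles*load : 3 ≤ n → ∑[ c ← chains n ] (middles c * load c) ≤ twoLayers n * middleMass
  ∑-middles*load 3≤n = begin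
    ∑[ c ← chains n ] (middles c * load c)
      ≡⟨ ∑-cong (chains n) (λ {c} _ → trans (∑-distribʳ-* F (load c) _)
                                             (∑-cong F (λ {B} _ → *-assoc ⟦ isMiddle B ⟧ _ _))) ⟩
    ∑[ c ← chains n ] ∑[ B ← F ] (⟦ isMiddle B ⟧ * (⟦ through c B ⟧ * load c))
      ≡⟨ ∑-comm (chains n) F _ ⟩
    ∑[ B ← F ] ∑[ c ← chains n ] (⟦ isMiddle B ⟧ * (⟦ through c B ⟧ * load c))
      ≡⟨ ∑-cong F (λ {B} _ → ∑-distribˡ-* (chains n) ⟦ isMiddle B ⟧ _) ⟩
    ∑[ B ← F ] (⟦ isMiddle B ⟧ * ∑[ c ← chains n ] (⟦ through c B ⟧ * load c))
      ≤⟨ ∑-mono F middle-term ⟩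
    ∑[ B ← F ] (twoLayers n * (⟦ isMiddle B ⟧ * chainsThrough B))
      ≡⟨ ∑-distribˡ-* F (twoLayers n) _ ⟩
    twoLayers n * middleMass
      ∎
    where
    open ≤-Reasoning
    middle-term : ∀ {B} → B ∈ F → ⟦ isMiddle B ⟧ * ∑[ c ← chains n ] (⟦ through c B ⟧ * load c)
                                    ≤ twoLayers n * (⟦ isMiddle B ⟧ * chainsThrough B)
    middle-term {B} b with middle? B
    ... | no  _  = z≤n
    ... | yes mB = begin
      1 * ∑[ c ← chains n ] (⟦ through c B ⟧ * load c)  ≡⟨ *-identityˡ _ ⟩
      ∑[ c ← chains n ] (⟦ through c B ⟧ * load c)      ≤⟨ ∑-load-through-middle 3≤n b mB ⟩
      twoLayers n * chainsThrough B                     ≡⟨ cong (twoLayers n *_) (*-identityˡ _) ⟨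
      twoLayers n * (1 * chainsThrough B)               ∎

  -- Since middles c ≤ 1, this says that a chain without a middle member has load at most
  -- twoLayers n, and is an identity otherwise; unlike a case split, it can be summed over chains.
  load-step : ∀ c → load c + twoLayers n * middles c ≤ twoLayers n + middles c * load c
  load-step c with middles c in middles≡ | middles≤1 c
  ... | 0 | _ = begin
    load c + twoLayers n * 0  ≡⟨ cong (load c +_) (*-zeroʳ (twoLayers n)) ⟩
    load c + 0                ≡⟨ +-identityʳ (load c) ⟩
    load c                    ≤⟨ load-without-middle c no-middle ⟩
    twoLayers n               ≡⟨ +-identityʳ (twoLayers n) ⟨
    twoLayers n + 0 * load c  ∎
    where
    open ≤-Reasoning
    no-middle : ∀ {B} → B ∈ F → Middle B → ¬ T (through c B)
    no-middle {B} b mB onB = contradiction (begin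
      1                                 ≡⟨ cong₂ _*_ (T⇒⟦⟧≡1 (fromWitness {a? = middle? B} mB)) (T⇒⟦⟧≡1 onB) ⟨
      ⟦ isMiddle B ⟧ * ⟦ through c B ⟧  ≤⟨ ∈⇒≤∑ (λ B → ⟦ isMiddle B ⟧ * ⟦ through c B ⟧) b ⟩
      middles c                         ≡⟨ middles≡ ⟩
      0                                 ∎) λ ()
  ... | 1 | _ = ≤-reflexive (begin
    load c + twoLayers n * 1  ≡⟨ cong (load c +_) (*-identityʳ (twoLayers n)) ⟩
    load c + twoLayers n      ≡⟨ +-comm (load c) (twoLayers n) ⟩
    twoLayers n + load c      ≡⟨ cong (twoLayers n +_) (*-identityˡ (load c)) ⟨
    twoLayers n + 1 * load c  ∎)
    where open ≡-Reasoning
  ... | suc (suc _) | s≤s ()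

  length≤twoLayers : 3 ≤ n → length F ≤ twoLayers n
  length≤twoLayers 3≤n = *-cancelʳ-≤ (length F) S (n !) {{n !≢0}} (+-cancelʳ-≤ (S * middleMass) _ _ (begin
    length F * n ! + S * middleMass
      ≡⟨ cong₂ _+_ ∑-load (cong (S *_) ∑-middles) ⟨
    ∑[ c ← chains n ] load c + S * ∑[ c ← chains n ] middles c
      ≡⟨ cong (∑[ c ← chains n ] load c +_) (∑-distribˡ-* (chains n) S middles) ⟨
    ∑[ c ← chains n ] load c + ∑[ c ← chains n ] (S * middles c)
      ≡⟨ ∑-distrib-+ (chains n) load (λ c → S * middles c) ⟨
    ∑[ c ← chains n ] (load c + S * middles c)
      ≤⟨ ∑-mono (chains n) (λ {c} _ → load-step c) ⟩
    ∑[ c ← chains n ] (S + middles c * load c)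
      ≡⟨ ∑-distrib-+ (chains n) (λ _ → S) _ ⟩
    ∑[ _ ← chains n ] S + ∑[ c ← chains n ] (middles c * load c)
      ≤⟨ +-mono-≤ (≤-reflexive (∑-chains-const n S)) (∑-middles*load 3≤n) ⟩
    n ! * S + S * middleMass
      ≡⟨ cong (_+ S * middleMass) (*-comm (n !) S) ⟩
    S * n ! + S * middleMass
      ∎))
    where
    open ≤-Reasoning
    S = twoLayers n

theorem1 : (n : ℕ) → 3 ≤ n → (F : List (Subset n)) → Unique F → Forbidden F →
    length F ≤ n C (n / 2) + n C (n / 2 + 1)
theorem1 n 3≤n F unique forbidden = ButterflyFree.length≤twoLayers unique forbidden 3≤n
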